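{- Let $\Pi$ be a (finite, nonempty) set of patterns, $k=\max_{\pi\in\Pi}|\pi|$, and let $\tau\in S_n$. For every integer $i\ge 0$, \[ P_i(\tau)=\begin{cases} P_{i+1}(\tau)+P_i(\tau\downarrow_{i+1}) & \text{if } i<n \text{ and } i\le k,\\ 1 & \text{if } i=n \text{ and } \tau\in\Pi,\\ 0 & \text{otherwise.}\end{cases}\]
   Context: A permutation in $S_n$ is a word containing each of $1,\dots,n$ exactly once. The standardization $\mathrm{st}(w)$ of a word $w$ of $m$ distinct letters is the unique $\sigma\in S_m$ with $w_a<w_b\iff\sigma_a<\sigma_b$. For $\pi\in S_m$ and $\tau\in S_n$, a $\pi$-hit in $\tau$ is an $m$-letter subsequence of $\tau$ whose standardization is $\pi$; a $\Pi$-hit is a $\pi$-hit for some $\pi\in\Pi$. For $\tau\in S_n$ and $i\in\{1,\dots,n\}$, $\tau\downarrow_i$ is the standardization of the word obtained from $\tau$ by deleting the letter $n-i+1$ (the $i$-th largest letter). The $i$-upfix of $\tau$ is the set of its $i$ largest letters $n-i+1,\dots,n$ (the $0$-upfix is empty). $P_i(\tau)$ denotes the number of $\Pi$-hits in $\tau$ that contain every letter of the $i$-upfix of $\tau$. -}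

module Defs where

open import Data.Nat using (ℕ; zero; suc; _+_; _∸_; _⊔_; _<_; _≤_; _<?_; _≟_)
open import Data.List using (List; []; _∷_; map; filter; length; upTo; foldr)
open import Data.List.Properties using (≡-dec)
open import Data.List.Relation.Binary.Permutation.Propositional using (_↭_)
open import Data.List.Relation.Unary.All using (All; all?)
open import Data.List.Membership.Propositional using (_∈_)
open import Data.List.Membership.DecPropositional (_≟_) using (_∈?_)
import Data.List.Membership.DecPropositional as DecMem
open import Data.List using (_++_)
open import Data.Product using (_×_)
open import Relation.Nullary using (¬_; Dec)
open import Relation.Nullary.Decidable using (_×-dec_; ¬?)

-- Words are lists of natural numbers (letters are 1-based, as in the paper).

IsPermOf : ℕ → List ℕ → Set
IsPermOf n w = w ↭ map suc (upTo n)

IsPerm : List ℕ → Set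
IsPerm w = IsPermOf (length w) w

-- Standardization: each letter x is replaced by 1 + #(letters of w smaller than x).
-- For words of distinct letters this is the unique order-isomorphic permutation.
st : List ℕ → List ℕ
st w = map (λ x → suc (length (filter (_<? x) w))) w

-- All subsequences (choices of a set of positions), duplicates kept per position set.
subsequences : List ℕ → List (List ℕ)
subsequences []       = [] ∷ []
subsequences (x ∷ xs) = map (x ∷_) (subsequences xs) ++ subsequences xs

-- s contains every letter of the i-upfix of a permutation in S_n,
-- i.e. the letters n, n-1, …, n-i+1.  For i > n the i-upfix does not exist
-- inside {1,…,n}, and the condition is unsatisfiable (j < n fails).
ContainsUpfix : ℕ → ℕ → List ℕ → Set
ContainsUpfix n i s = All (λ j → (j < n) × ((n ∸ j) ∈ s)) (upTo i)

containsUpfix? : ∀ n i s → Dec (ContainsUpfix n i s)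
containsUpfix? n i s = all? (λ j → (j <? n) ×-dec ((n ∸ j) ∈? s)) (upTo i)

isHit? : (Π : List (List ℕ)) (s : List ℕ) → Dec (st s ∈ Π)
isHit? Π s = DecMem._∈?_ (≡-dec _≟_) (st s) Π

P : List (List ℕ) → ℕ → List ℕ → ℕ
P Π i τ = length (filter (isHit? Π) (filter (containsUpfix? (length τ) i) (subsequences τ)))

down : List ℕ → ℕ → List ℕ
down τ i = st (filter (λ x → ¬? (x ≟ (length τ ∸ i + 1))) τ)

maxLen : List (List ℕ) → ℕ
maxLen Π = foldr _⊔_ 0 (map length Π)

-- Let d = n - i be the next letter of the upfix.  Hits containing
--    the i-upfix and d are exactly those containing the (i+1)-upfix; the others are the
--    subsequences of τ with d deleted.  The order-preserving relabelling `closeGap d`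
--    (lower every letter above d by one) turns these into the subsequences of τ↓_{i+1},
--    preserving standardization and carrying the i-upfix of S_n to that of S_{n-1}.
--  * i = n.  The only subsequence of τ containing all n letters is τ itself, and st τ = τ.
--  * Vanishing.  For i > n the i-upfix does not fit in {1,…,n}; for k < i < n a hit has
--    at most k letters (its standardization lies in Π) yet contains the i upfix letters.

module Submission where

open import Defs
open import Data.Nat using (ℕ; suc; _+_; _<_; _≤_)
open import Data.List using (List; [])
open import Data.List.Membership.Propositional using (_∈_)
open import Data.Product using (_×_)
open import Relation.Nullary using (¬_)
open import Relation.Binary.PropositionalEquality using (_≡_; _≢_)

open import Data.Nat using (zero; pred; _∸_; _≡ᵇ_; _<ᵇ_; z≤n; s≤s; z<s)
open import Data.Nat.Properties
open import Data.Bool using (Bool; true; false; not; _∧_; if_then_else_)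
open import Data.Bool.Properties using (T-≡; ∧-zeroʳ; ∧-identityʳ)
open import Data.List using (_∷_; map; filter; length; upTo; applyUpTo; _++_)
open import Data.List.Properties using (length-map; map-upTo; map-∘; length-upTo; map-++; map-cong-local; map-id-local; ≡-dec; filter-accept; filter-reject)
open import Data.List.Membership.Propositional using (_∉_)
open import Data.List.Membership.Propositional.Properties using (∈-++⁻; ∈-++⁺ˡ; ∈-++⁺ʳ; ∈-map⁺; ∈-map⁻; ∈-upTo⁺; ∈-upTo⁻; ∈-filter⁻)
import Data.List.Membership.DecPropositional as DecMembership
open import Data.List.Relation.Unary.Any using (here; there)
import Data.List.Relation.Unary.All as All
open import Data.List.Relation.Binary.Permutation.Propositional as Perm using (_↭_; prep; swap; ↭-sym)
open import Data.List.Relation.Binary.Permutation.Propositional.Properties using (∈-resp-↭; ↭-length)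
open import Data.Product using (_,_; proj₁; proj₂; Σ)
open import Data.Sum using (inj₁; inj₂)
open import Data.Empty using (⊥-elim)
open import Function.Bundles using (Equivalence)
open import Relation.Nullary using (Dec; yes; no; does)
open import Relation.Nullary.Decidable using (¬?)
open import Relation.Unary using (Decidable)
open import Relation.Binary.Definitions using (tri<; tri≈; tri>)
open import Relation.Binary.PropositionalEquality using (refl; sym; trans; cong; cong₂; subst; module ≡-Reasoning)

bool-ext : ∀ {a b : Bool} → (a ≡ true → b ≡ true) → (b ≡ true → a ≡ true) → a ≡ b
bool-ext {true}  {true}  f g = refl
bool-ext {true}  {false} f g = sym (f refl)
bool-ext {false} {true}  f g = g refl
bool-ext {false} {false} f g = refl

∧-trueˡ : ∀ {a b : Bool} → (a ∧ b) ≡ true → a ≡ true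
∧-trueˡ {true} e = refl

∧-trueʳ : ∀ {a b : Bool} → (a ∧ b) ≡ true → b ≡ true
∧-trueʳ {true} e = e

∧-true : ∀ {a b : Bool} → a ≡ true → b ≡ true → (a ∧ b) ≡ true
∧-true refl refl = refl

∧-swapʳ : ∀ a b c → ((a ∧ b) ∧ c) ≡ ((a ∧ c) ∧ b)
∧-swapʳ true  true  true  = refl
∧-swapʳ true  true  false = refl
∧-swapʳ true  false true  = refl
∧-swapʳ true  false false = refl
∧-swapʳ false b     c     = refl

does-true : {A : Set} (A? : Dec A) → A → does A? ≡ true
does-true (yes _) _ = refl
does-true (no ¬a) a = ⊥-elim (¬a a)

does-false : {A : Set} (A? : Dec A) → ¬ A → does A? ≡ false
does-false (yes a) ¬a = ⊥-elim (¬a a)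
does-false (no _)  _  = refl

does-true⁻ : {A : Set} (A? : Dec A) → does A? ≡ true → A
does-true⁻ (yes a) _ = a

<ᵇ-true : ∀ {a b} → a < b → (a <ᵇ b) ≡ true
<ᵇ-true a<b = Equivalence.to T-≡ (<⇒<ᵇ a<b)

<ᵇ-true⁻ : ∀ a b → (a <ᵇ b) ≡ true → a < b
<ᵇ-true⁻ a b e = <ᵇ⇒< a b (Equivalence.from T-≡ e)

<ᵇ-false : ∀ {a b} → b ≤ a → (a <ᵇ b) ≡ false
<ᵇ-false {a} {b} b≤a with a <ᵇ b in eq
... | false = refl
... | true  = ⊥-elim (<⇒≱ (<ᵇ-true⁻ a b eq) b≤a)

<ᵇ-false⁻ : ∀ a b → (a <ᵇ b) ≡ false → b ≤ a
<ᵇ-false⁻ a b e = ≮⇒≥ (λ a<b → false≢true (trans (sym e) (<ᵇ-true a<b)))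
  where
  false≢true : false ≢ true
  false≢true ()

≡ᵇ-refl : ∀ x → (x ≡ᵇ x) ≡ true
≡ᵇ-refl x = Equivalence.to T-≡ (≡⇒≡ᵇ x x refl)

open DecMembership _≟_ using (_∈?_)

mem : ℕ → List ℕ → Bool
mem d s = does (d ∈? s)

mem-cons-other : ∀ x d s → x ≢ d → mem d (x ∷ s) ≡ mem d s
mem-cons-other x d s x≢d = bool-ext fw bw
  where
  fw : mem d (x ∷ s) ≡ true → mem d s ≡ true
  fw e with does-true⁻ (d ∈? (x ∷ s)) e
  ... | here d≡x = ⊥-elim (x≢d (sym d≡x))
  ... | there d∈s = does-true (d ∈? s) d∈s
  bw : mem d s ≡ true → mem d (x ∷ s) ≡ true
  bw e = does-true (d ∈? (x ∷ s)) (there (does-true⁻ (d ∈? s) e))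

count : {A : Set} → (A → Bool) → List A → ℕ
count p []       = 0
count p (x ∷ xs) = if p x then suc (count p xs) else count p xs

count-++ : {A : Set} (p : A → Bool) (xs ys : List A) → count p (xs ++ ys) ≡ count p xs + count p ys
count-++ p []       ys = refl
count-++ p (x ∷ xs) ys with p x
... | true  = cong suc (count-++ p xs ys)
... | false = count-++ p xs ys

count-map : {A B : Set} (p : B → Bool) (f : A → B) (xs : List A) →
  count p (map f xs) ≡ count (λ x → p (f x)) xs
count-map p f []       = refl
count-map p f (x ∷ xs) with p (f x)
... | true  = cong suc (count-map p f xs)
... | false = count-map p f xs

count-cong : {A : Set} (p q : A → Bool) (xs : List A) →
  (∀ x → x ∈ xs → p x ≡ q x) → count p xs ≡ count q xs
count-cong p q []       h = refl
count-cong p q (x ∷ xs) h with p x | q x | h x (here refl)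
... | true  | true  | _ = cong suc (count-cong p q xs (λ y y∈ → h y (there y∈)))
... | false | false | _ = count-cong p q xs (λ y y∈ → h y (there y∈))

count-none : {A : Set} (p : A → Bool) (xs : List A) → (∀ x → x ∈ xs → p x ≡ false) → count p xs ≡ 0
count-none p []       h = refl
count-none p (x ∷ xs) h with p x | h x (here refl)
... | false | _ = count-none p xs (λ y y∈ → h y (there y∈))

count-all : {A : Set} (p : A → Bool) (xs : List A) → (∀ x → x ∈ xs → p x ≡ true) → count p xs ≡ length xs
count-all p []       h = refl
count-all p (x ∷ xs) h with p x | h x (here refl)
... | true | _ = cong suc (count-all p xs (λ y y∈ → h y (there y∈)))

count-split : {A : Set} (p q : A → Bool) (xs : List A) →
  count p xs ≡ count (λ x → p x ∧ q x) xs + count (λ x → p x ∧ not (q x)) xs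
count-split p q []       = refl
count-split p q (x ∷ xs) with p x | q x
... | true  | true  = cong suc (count-split p q xs)
... | true  | false = trans (cong suc (count-split p q xs)) (sym (+-suc _ _))
... | false | _     = count-split p q xs

count≤length : {A : Set} (p : A → Bool) (xs : List A) → count p xs ≤ length xs
count≤length p []       = z≤n
count≤length p (x ∷ xs) with p x
... | true  = s≤s (count≤length p xs)
... | false = m≤n⇒m≤1+n (count≤length p xs)

count-pos : {A : Set} (p : A → Bool) (xs : List A) (x : A) → x ∈ xs → p x ≡ true → 1 ≤ count p xs
count-pos p (y ∷ xs) x (here refl) px rewrite px = s≤s z≤n
count-pos p (y ∷ xs) x (there x∈) px with p y
... | true  = s≤s z≤n
... | false = count-pos p xs x x∈ px

count-↭ : {A : Set} (p : A → Bool) {xs ys : List A} → xs ↭ ys → count p xs ≡ count p ys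
count-↭ p Perm.refl = refl
count-↭ p (prep x r) with p x
... | true  = cong suc (count-↭ p r)
... | false = count-↭ p r
count-↭ p (swap x y r) with p x | p y
... | true  | true  = cong (λ c → suc (suc c)) (count-↭ p r)
... | true  | false = cong suc (count-↭ p r)
... | false | true  = cong suc (count-↭ p r)
... | false | false = count-↭ p r
count-↭ p (Perm.trans r₁ r₂) = trans (count-↭ p r₁) (count-↭ p r₂)

length-filter-count : {A : Set} {R : A → Set} (R? : Decidable R) (xs : List A) →
  length (filter R? xs) ≡ count (λ x → does (R? x)) xs
length-filter-count R? []       = refl
length-filter-count R? (x ∷ xs) with does (R? x)
... | true  = cong suc (length-filter-count R? xs)
... | false = length-filter-count R? xs

count-filter : {A : Set} {R : A → Set} (R? : Decidable R) (p : A → Bool) (xs : List A) →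
  count p (filter R? xs) ≡ count (λ x → does (R? x) ∧ p x) xs
count-filter R? p []       = refl
count-filter R? p (x ∷ xs) with does (R? x)
... | false = count-filter R? p xs
... | true with p x
...   | true  = cong suc (count-filter R? p xs)
...   | false = count-filter R? p xs

-- Counts over the range 0,…,N-1.  Since upTo (suc N) = 0 ∷ applyUpTo suc N, the
-- step case of each induction shifts the range down by one.

count-shift : ∀ (p : ℕ → Bool) N → count p (applyUpTo suc N) ≡ count (λ y → p (suc y)) (upTo N)
count-shift p N = trans (cong (count p) (sym (map-upTo suc N))) (count-map p suc (upTo N))

count-below : ∀ N a → a ≤ N → count (λ y → y <ᵇ a) (upTo N) ≡ a
count-below zero    .zero   z≤n       = refl
count-below (suc N) zero    _         = count-none _ (applyUpTo suc N) (λ _ _ → refl)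
count-below (suc N) (suc a) (s≤s a≤N) = cong suc (trans (count-shift _ N) (count-below N a a≤N))

count-atLeast : ∀ N a → a ≤ N → count (λ y → not (y <ᵇ a)) (upTo N) ≡ N ∸ a
count-atLeast N a a≤N = begin
    count (λ y → not (y <ᵇ a)) (upTo N)
  ≡⟨ sym (m+n∸m≡n a _) ⟩
    a + count (λ y → not (y <ᵇ a)) (upTo N) ∸ a
  ≡⟨ cong (λ t → t + count (λ y → not (y <ᵇ a)) (upTo N) ∸ a) (sym (count-below N a a≤N)) ⟩
    count (λ y → y <ᵇ a) (upTo N) + count (λ y → not (y <ᵇ a)) (upTo N) ∸ a
  ≡⟨ cong (_∸ a) (sym (count-split (λ _ → true) (λ y → y <ᵇ a) (upTo N))) ⟩
    count (λ _ → true) (upTo N) ∸ a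
  ≡⟨ cong (_∸ a) (trans (count-all (λ _ → true) (upTo N) (λ _ _ → refl)) (length-upTo N)) ⟩
    N ∸ a ∎
  where open ≡-Reasoning

-- closeGap d relabels the letters of a word from which d was deleted: letters above d move
-- down by one, the others stay.  It is the standardizing map of such a word.
closeGap : ℕ → ℕ → ℕ
closeGap d x = if d <ᵇ x then pred x else x

suc-closeGap : ∀ d a → suc (closeGap d a) ≡ (if d <ᵇ a then a else suc a)
suc-closeGap zero    zero    = refl
suc-closeGap (suc d) zero    = refl
suc-closeGap d       (suc a) with d <ᵇ suc a
... | true  = refl
... | false = refl

-- #{y < N : y ≠ e, y < a} = closeGap e a: deleting e lowers the rank of a exactly when e < a.
count-below-except : ∀ N a e → a ≤ N →
  count (λ y → not (y ≡ᵇ e) ∧ (y <ᵇ a)) (upTo N) ≡ closeGap e a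
count-below-except zero    zero    zero    z≤n = refl
count-below-except zero    zero    (suc e) z≤n = refl
count-below-except (suc N) zero    e       _   =
  trans (count-none _ (upTo (suc N)) (λ y _ → ∧-zeroʳ _)) (closeGap-zero e)
  where
  closeGap-zero : ∀ e → 0 ≡ closeGap e 0
  closeGap-zero zero    = refl
  closeGap-zero (suc e) = refl
count-below-except (suc N) (suc a) zero    (s≤s a≤N) = trans (count-shift _ N) (count-below N a a≤N)
count-below-except (suc N) (suc a) (suc e) (s≤s a≤N) =
  trans (cong suc (trans (count-shift _ N) (count-below-except N a e a≤N))) (suc-closeGap e a)

Distinct : List ℕ → Set
Distinct xs = ∀ z → count (λ y → y ≡ᵇ z) xs ≤ 1

upTo-distinct : ∀ N → Distinct (upTo N)
upTo-distinct zero    z       = z≤n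
upTo-distinct (suc N) zero    rewrite count-shift (λ y → y ≡ᵇ 0) N
  | count-none (λ y → suc y ≡ᵇ 0) (upTo N) (λ _ _ → refl) = s≤s z≤n
upTo-distinct (suc N) (suc z) rewrite count-shift (λ y → y ≡ᵇ suc z) N = upTo-distinct N z

Distinct-tail : ∀ x xs → Distinct (x ∷ xs) → Distinct xs
Distinct-tail x xs d z with d z
... | h with x ≡ᵇ z
...   | true  = ≤-trans (n≤1+n _) h
...   | false = h

Distinct-head : ∀ x xs → Distinct (x ∷ xs) → x ∉ xs
Distinct-head x xs d x∈xs
  with ≤-trans (s≤s (count-pos (λ y → y ≡ᵇ x) xs x x∈xs (≡ᵇ-refl x)))
         (subst (λ b → (if b then suc (count (λ y → y ≡ᵇ x) xs) else count (λ y → y ≡ᵇ x) xs) ≤ 1)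
                (≡ᵇ-refl x) (d x))
... | s≤s ()

subsequence-⊆ : (xs s : List ℕ) → s ∈ subsequences xs → ∀ y → y ∈ s → y ∈ xs
subsequence-⊆ []       .[] (here refl) y ()
subsequence-⊆ (x ∷ xs) s   s∈ y y∈s with ∈-++⁻ (map (x ∷_) (subsequences xs)) s∈
... | inj₂ s∈′ = there (subsequence-⊆ xs s s∈′ y y∈s)
... | inj₁ s∈′ with ∈-map⁻ (x ∷_) s∈′
...   | s′ , s′∈ , refl with y∈s
...     | here refl = here refl
...     | there y∈s′ = there (subsequence-⊆ xs s′ s′∈ y y∈s′)

subsequences-map : (g : ℕ → ℕ) (xs : List ℕ) → subsequences (map g xs) ≡ map (map g) (subsequences xs)
subsequences-map g []       = refl
subsequences-map g (x ∷ xs) rewrite subsequences-map g xs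
  | map-++ (map g) (map (x ∷_) (subsequences xs)) (subsequences xs)
  | sym (map-∘ {g = g x ∷_} {f = map g} (subsequences xs))
  | sym (map-∘ {g = map g} {f = x ∷_} (subsequences xs)) = refl

count-covering : ∀ xs (p : List ℕ → Bool) → Distinct xs →
  (∀ s → s ∈ subsequences xs → p s ≡ true → ∀ y → y ∈ xs → y ∈ s) →
  count p (subsequences xs) ≡ (if p xs then 1 else 0)
count-covering []       p dist h = refl
count-covering (x ∷ ys) p dist h = begin
    count p (map (x ∷_) S ++ S)
  ≡⟨ count-++ p (map (x ∷_) S) S ⟩
    count p (map (x ∷_) S) + count p S
  ≡⟨ cong₂ _+_ (count-map p (x ∷_) S) (count-none p S without-x) ⟩
    count (λ s → p (x ∷ s)) S + 0
  ≡⟨ +-identityʳ _ ⟩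
    count (λ s → p (x ∷ s)) S
  ≡⟨ count-covering ys (λ s → p (x ∷ s)) (Distinct-tail x ys dist) with-x ⟩
    (if p (x ∷ ys) then 1 else 0) ∎
  where
  open ≡-Reasoning
  S = subsequences ys
  x∉ys = Distinct-head x ys dist
  without-x : ∀ s → s ∈ S → p s ≡ false
  without-x s s∈ with p s in eq
  ... | false = refl
  ... | true  = ⊥-elim (x∉ys (subsequence-⊆ ys s s∈ x (h s (∈-++⁺ʳ (map (x ∷_) S) s∈) eq x (here refl))))
  with-x : ∀ s → s ∈ S → p (x ∷ s) ≡ true → ∀ y → y ∈ ys → y ∈ s
  with-x s s∈ e y y∈ys with h (x ∷ s) (∈-++⁺ˡ (∈-map⁺ (x ∷_) s∈)) e y (there y∈ys)
  ... | here refl = ⊥-elim (x∉ys y∈ys)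
  ... | there y∈s = y∈s

covering-tail : ∀ x ys (q : ℕ → Bool) {s′} → Distinct (x ∷ ys) →
  (∀ y → y ∈ x ∷ ys → q y ≡ true → y ∈ x ∷ s′) → ∀ y → y ∈ ys → q y ≡ true → y ∈ s′
covering-tail x ys q dist h y y∈ e with h y (there y∈) e
... | here refl  = ⊥-elim (Distinct-head x ys dist y∈)
... | there y∈s′ = y∈s′

count-on-covering : ∀ xs s (q : ℕ → Bool) → Distinct xs → s ∈ subsequences xs →
  (∀ y → y ∈ xs → q y ≡ true → y ∈ s) → count q s ≡ count q xs
count-on-covering []       .[] q dist (here refl) h = refl
count-on-covering (x ∷ ys) s   q dist s∈ h with ∈-++⁻ (map (x ∷_) (subsequences ys)) s∈
... | inj₂ s∈′ with q x in eq
...   | true  = ⊥-elim (Distinct-head x ys dist (subsequence-⊆ ys s s∈′ x (h x (here refl) eq)))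
...   | false = count-on-covering ys s q (Distinct-tail x ys dist) s∈′ (λ y y∈ e → h y (there y∈) e)
count-on-covering (x ∷ ys) s   q dist s∈ h | inj₁ s∈′ with ∈-map⁻ (x ∷_) s∈′
... | s′ , s′∈ , refl with q x
...   | true  = cong suc (count-on-covering ys s′ q (Distinct-tail x ys dist) s′∈ (covering-tail x ys q dist h))
...   | false = count-on-covering ys s′ q (Distinct-tail x ys dist) s′∈ (covering-tail x ys q dist h)

delete : ℕ → List ℕ → List ℕ
delete d = filter (λ x → ¬? (x ≟ d))

count-avoiding : ∀ d (p : List ℕ → Bool) xs →
  count (λ s → p s ∧ not (mem d s)) (subsequences xs) ≡ count p (subsequences (delete d xs))
count-avoiding d p []       = cong (λ b → if b then 1 else 0) (∧-identityʳ (p []))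
count-avoiding d p (x ∷ ys) with x ≟ d
... | yes refl = begin
    count (λ s → p s ∧ not (mem x s)) (map (x ∷_) S ++ S)
  ≡⟨ count-++ _ (map (x ∷_) S) S ⟩
    count (λ s → p s ∧ not (mem x s)) (map (x ∷_) S) + count (λ s → p s ∧ not (mem x s)) S
  ≡⟨ cong (_+ count (λ s → p s ∧ not (mem x s)) S)
       (trans (count-map _ (x ∷_) S) (count-none _ S (λ s _ → contains-x s))) ⟩
    count (λ s → p s ∧ not (mem x s)) S
  ≡⟨ count-avoiding x p ys ⟩
    count p (subsequences (delete x ys))
  ≡⟨ cong (λ l → count p (subsequences l)) (sym (filter-reject (λ z → ¬? (z ≟ x)) (λ ne → ne refl))) ⟩
    count p (subsequences (delete x (x ∷ ys))) ∎
  where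
  open ≡-Reasoning
  S = subsequences ys
  contains-x : ∀ s → (p (x ∷ s) ∧ not (mem x (x ∷ s))) ≡ false
  contains-x s = trans (cong (λ b → p (x ∷ s) ∧ not b) (does-true (x ∈? (x ∷ s)) (here refl))) (∧-zeroʳ _)
... | no x≢d = begin
    count (λ s → p s ∧ not (mem d s)) (map (x ∷_) S ++ S)
  ≡⟨ count-++ _ (map (x ∷_) S) S ⟩
    count (λ s → p s ∧ not (mem d s)) (map (x ∷_) S) + count (λ s → p s ∧ not (mem d s)) S
  ≡⟨ cong₂ _+_ (trans (count-map _ (x ∷_) S)
                 (count-cong _ _ S (λ s _ → cong (λ b → p (x ∷ s) ∧ not b) (mem-cons-other x d s x≢d))))
               (count-avoiding d p ys) ⟩
    count (λ s → p (x ∷ s) ∧ not (mem d s)) S + count p F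
  ≡⟨ cong (_+ count p F) (count-avoiding d (λ s → p (x ∷ s)) ys) ⟩
    count (λ s → p (x ∷ s)) F + count p F
  ≡⟨ cong (_+ count p F) (sym (count-map p (x ∷_) F)) ⟩
    count p (map (x ∷_) F) + count p F
  ≡⟨ sym (count-++ p (map (x ∷_) F) F) ⟩
    count p (subsequences (x ∷ delete d ys))
  ≡⟨ cong (λ l → count p (subsequences l)) (sym (filter-accept (λ z → ¬? (z ≟ d)) x≢d)) ⟩
    count p (subsequences (delete d (x ∷ ys))) ∎
  where
  open ≡-Reasoning
  S = subsequences ys
  F = subsequences (delete d ys)

hasUpfix : ℕ → ℕ → List ℕ → Bool
hasUpfix N i s = does (containsUpfix? N i s)

hasUpfix⁻ : ∀ N i s → hasUpfix N i s ≡ true → ∀ j → j < i → (j < N) × ((N ∸ j) ∈ s)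
hasUpfix⁻ N i s e j j<i = All.lookup (does-true⁻ (containsUpfix? N i s) e) (∈-upTo⁺ j<i)

hasUpfix⁺ : ∀ N i s → (∀ j → j < i → (j < N) × ((N ∸ j) ∈ s)) → hasUpfix N i s ≡ true
hasUpfix⁺ N i s h = does-true (containsUpfix? N i s) (All.tabulate (λ j∈ → h _ (∈-upTo⁻ j∈)))

hasUpfix-beyond : ∀ N i s → N < i → hasUpfix N i s ≡ false
hasUpfix-beyond N i s N<i with hasUpfix N i s in eq
... | false = refl
... | true  = ⊥-elim (<-irrefl refl (proj₁ (hasUpfix⁻ N i s eq N N<i)))

hasUpfix-suc : ∀ N i s → i < N → hasUpfix N (suc i) s ≡ (hasUpfix N i s ∧ mem (N ∸ i) s)
hasUpfix-suc N i s i<N = bool-ext fw bw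
  where
  fw : hasUpfix N (suc i) s ≡ true → (hasUpfix N i s ∧ mem (N ∸ i) s) ≡ true
  fw e = ∧-true (hasUpfix⁺ N i s (λ j j<i → hasUpfix⁻ N (suc i) s e j (m≤n⇒m≤1+n j<i)))
                (does-true (_ ∈? s) (proj₂ (hasUpfix⁻ N (suc i) s e i ≤-refl)))
  bw : (hasUpfix N i s ∧ mem (N ∸ i) s) ≡ true → hasUpfix N (suc i) s ≡ true
  bw e = hasUpfix⁺ N (suc i) s h
    where
    h : ∀ j → j < suc i → (j < N) × ((N ∸ j) ∈ s)
    h j j<1+i with m≤n⇒m<n∨m≡n (≤-pred j<1+i)
    ... | inj₁ j<i  = hasUpfix⁻ N i s (∧-trueˡ e) j j<i
    ... | inj₂ refl = i<N , does-true⁻ (_ ∈? s) (∧-trueʳ e)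

closeGap-<ᵇ : ∀ d z x → z ≢ d → x ≢ d → (closeGap d z <ᵇ closeGap d x) ≡ (z <ᵇ x)
closeGap-<ᵇ d z x z≢d x≢d with d <ᵇ z in ez | d <ᵇ x in ex
... | true  | true  with <ᵇ-true⁻ d z ez | <ᵇ-true⁻ d x ex
...   | s≤s _ | s≤s _ with z | x
...     | suc z′ | suc x′ = refl
closeGap-<ᵇ d z x z≢d x≢d | true  | false with <ᵇ-true⁻ d z ez | <ᵇ-false⁻ d x ex
... | s≤s d≤z′ | x≤d = trans (<ᵇ-false (<⇒≤ (≤-trans x<d d≤z′)))
                             (sym (<ᵇ-false (<⇒≤ (≤-trans x<d (m≤n⇒m≤1+n d≤z′)))))
  where x<d = ≤∧≢⇒< x≤d x≢d
closeGap-<ᵇ d z x z≢d x≢d | false | true  with <ᵇ-false⁻ d z ez | <ᵇ-true⁻ d x ex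
... | z≤d | s≤s d≤x′ = trans (<ᵇ-true (<-≤-trans z<d d≤x′))
                             (sym (<ᵇ-true (<-≤-trans z<d (m≤n⇒m≤1+n d≤x′))))
  where z<d = ≤∧≢⇒< z≤d z≢d
closeGap-<ᵇ d z x z≢d x≢d | false | false = refl

st-closeGap : ∀ d s → (∀ y → y ∈ s → y ≢ d) → st (map (closeGap d) s) ≡ st s
st-closeGap d s s∌d = begin
    map (λ y → suc (length (filter (_<? y) (map g s)))) (map g s)
  ≡⟨ sym (map-∘ s) ⟩
    map (λ x → suc (length (filter (_<? g x) (map g s)))) s
  ≡⟨ map-cong-local (All.tabulate (λ {x} x∈ → cong suc (rank x x∈))) ⟩
    map (λ x → suc (length (filter (_<? x) s))) s ∎
  where
  open ≡-Reasoning
  g = closeGap d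
  rank : ∀ x → x ∈ s → length (filter (_<? g x) (map g s)) ≡ length (filter (_<? x) s)
  rank x x∈ = begin
      length (filter (_<? g x) (map g s))
    ≡⟨ length-filter-count (_<? g x) (map g s) ⟩
      count (λ y → y <ᵇ g x) (map g s)
    ≡⟨ count-map _ g s ⟩
      count (λ z → g z <ᵇ g x) s
    ≡⟨ count-cong _ _ s (λ z z∈ → closeGap-<ᵇ d z x (s∌d z z∈) (s∌d x x∈)) ⟩
      count (λ z → z <ᵇ x) s
    ≡⟨ sym (length-filter-count (_<? x) s) ⟩
      length (filter (_<? x) s) ∎

closeGap-suc : ∀ d y → d ≤ y → closeGap d (suc y) ≡ y
closeGap-suc d y d≤y rewrite <ᵇ-true (s≤s d≤y) = refl

closeGap-from-above : ∀ d x y → x ≢ d → d ≤ y → closeGap d x ≡ y → x ≡ suc y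
closeGap-from-above d x y x≢d d≤y gx≡y with d <ᵇ x in e
... | true  with <ᵇ-true⁻ d x e
...   | s≤s _ = cong suc gx≡y
closeGap-from-above d x y x≢d d≤y refl | false =
  ⊥-elim (<-irrefl refl (<-≤-trans (≤∧≢⇒< (<ᵇ-false⁻ d x e) x≢d) d≤y))

hasUpfix-closeGap : ∀ m i s → i ≤ m → (∀ y → y ∈ s → y ≢ suc (m ∸ i)) →
  hasUpfix m i (map (closeGap (suc (m ∸ i))) s) ≡ hasUpfix (suc m) i s
hasUpfix-closeGap m i s i≤m s∌d = bool-ext fw bw
  where
  d = suc (m ∸ i)
  g = closeGap d
  letter : ∀ j → j < i → suc m ∸ j ≡ suc (m ∸ j)
  letter j j<i = +-∸-assoc 1 (<⇒≤ (<-≤-trans j<i i≤m))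
  above-gap : ∀ j → j < i → d ≤ m ∸ j
  above-gap j j<i = ∸-monoʳ-< {m} {i} {j} j<i i≤m
  bw : hasUpfix (suc m) i s ≡ true → hasUpfix m i (map g s) ≡ true
  bw u = hasUpfix⁺ m i (map g s) λ j j<i →
    <-≤-trans j<i i≤m ,
    subst (_∈ map g s) (closeGap-suc d (m ∸ j) (above-gap j j<i))
      (∈-map⁺ g (subst (_∈ s) (letter j j<i) (proj₂ (hasUpfix⁻ (suc m) i s u j j<i))))
  fw : hasUpfix m i (map g s) ≡ true → hasUpfix (suc m) i s ≡ true
  fw u = hasUpfix⁺ (suc m) i s h
    where
    h : ∀ j → j < i → (j < suc m) × ((suc m ∸ j) ∈ s)
    h j j<i with hasUpfix⁻ m i (map g s) u j j<i
    ... | j<m , m∸j∈ with ∈-map⁻ g m∸j∈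
    ...   | x , x∈s , m∸j≡gx =
      m≤n⇒m≤1+n j<m ,
      subst (_∈ s) (sym (trans (letter j j<i)
        (sym (closeGap-from-above d x (m ∸ j) (s∌d x x∈s) (above-gap j j<i) (sym m∸j≡gx))))) x∈s

isHit : List (List ℕ) → List ℕ → Bool
isHit Π s = does (isHit? Π s)

P-as-count : ∀ Π i τ → P Π i τ ≡ count (λ s → hasUpfix (length τ) i s ∧ isHit Π s) (subsequences τ)
P-as-count Π i τ = trans (length-filter-count (isHit? Π) (filter (containsUpfix? (length τ) i) (subsequences τ)))
                         (count-filter (containsUpfix? (length τ) i) (isHit Π) (subsequences τ))

isHit-st : ∀ Π {s s′} → st s ≡ st s′ → isHit Π s ≡ isHit Π s′
isHit-st Π st≡ = cong (λ w → does (DecMembership._∈?_ (≡-dec _≟_) w Π)) st≡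

length≤maxLen : ∀ Π π → π ∈ Π → length π ≤ maxLen Π
length≤maxLen (x ∷ Π) π (here refl) = m≤m⊔n (length x) _
length≤maxLen (x ∷ Π) π (there π∈) = m≤n⇒m≤o⊔n (length x) (length≤maxLen Π π π∈)

upfix-index : ∀ N i y → i ≤ N → N ∸ i ≤ y → y < N → N ∸ suc y < i
upfix-index N zero     y _   N≤y y<N = ⊥-elim (<-irrefl refl (≤-<-trans N≤y y<N))
upfix-index N (suc i′) y i≤N h   y<N = ≤-<-trans (∸-monoʳ-≤ N (s≤s h))
  (subst (_< suc i′) (trans (cong pred (sym (m∸[m∸n]≡n i≤N))) (pred[m∸n]≡m∸[1+n] N (N ∸ suc i′))) ≤-refl)

<ᵇ-suc-not : ∀ a y → (a <ᵇ suc y) ≡ not (y <ᵇ a)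
<ᵇ-suc-not zero    y       = refl
<ᵇ-suc-not (suc a) zero    = refl
<ᵇ-suc-not (suc a) (suc y) = <ᵇ-suc-not a y

module Permutation (n : ℕ) (τ : List ℕ) (perm : IsPermOf n τ) where

  length-τ : length τ ≡ n
  length-τ = trans (↭-length perm) (trans (length-map suc (upTo n)) (length-upTo n))

  letter⁻ : ∀ x → x ∈ τ → Σ ℕ (λ y → (x ≡ suc y) × (y < n))
  letter⁻ x x∈ with ∈-map⁻ suc (∈-resp-↭ perm x∈)
  ... | y , y∈ , x≡1+y = y , x≡1+y , ∈-upTo⁻ y∈

  letter⁺ : ∀ y → y < n → suc y ∈ τ
  letter⁺ y y<n = ∈-resp-↭ (↭-sym perm) (∈-map⁺ suc (∈-upTo⁺ y<n))

  count-τ : ∀ (p : ℕ → Bool) → count p τ ≡ count (λ y → p (suc y)) (upTo n)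
  count-τ p = trans (count-↭ p perm) (count-map p suc (upTo n))

  distinct-τ : Distinct τ
  distinct-τ zero    rewrite count-τ (λ y → y ≡ᵇ 0)
    | count-none (λ y → suc y ≡ᵇ 0) (upTo n) (λ _ _ → refl) = z≤n
  distinct-τ (suc z) rewrite count-τ (λ y → y ≡ᵇ suc z) = upTo-distinct n z

  st-τ : st τ ≡ τ
  st-τ = map-id-local (All.tabulate (λ {x} x∈ → rank x x∈))
    where
    rank : ∀ x → x ∈ τ → suc (length (filter (_<? x) τ)) ≡ x
    rank x x∈ with letter⁻ x x∈
    ... | y , refl , y<n = cong suc (trans (length-filter-count (_<? suc y) τ)
                                      (trans (count-τ _) (count-below n y (<⇒≤ y<n))))

  -- P_n(τ) = [τ ∈ Π]: the only subsequence containing the n-upfix is τ itself.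
  P-full : ∀ Π → P Π n τ ≡ (if isHit Π τ then 1 else 0)
  P-full Π = begin
      P Π n τ
    ≡⟨ P-as-count Π n τ ⟩
      count (λ s → hasUpfix (length τ) n s ∧ isHit Π s) (subsequences τ)
    ≡⟨ cong (λ N → count (λ s → hasUpfix N n s ∧ isHit Π s) (subsequences τ)) length-τ ⟩
      count (λ s → hasUpfix n n s ∧ isHit Π s) (subsequences τ)
    ≡⟨ count-covering τ (λ s → hasUpfix n n s ∧ isHit Π s) distinct-τ covers ⟩
      (if hasUpfix n n τ ∧ isHit Π τ then 1 else 0)
    ≡⟨ cong (λ b → if b ∧ isHit Π τ then 1 else 0) τ-has-upfix ⟩
      (if isHit Π τ then 1 else 0) ∎
    where
    open ≡-Reasoning
    covers : ∀ s → s ∈ subsequences τ → (hasUpfix n n s ∧ isHit Π s) ≡ true → ∀ x → x ∈ τ → x ∈ s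
    covers s _ e x x∈ with letter⁻ x x∈
    ... | y , refl , y<n = subst (_∈ s) (m∸[m∸n]≡n y<n)
          (proj₂ (hasUpfix⁻ n n s (∧-trueˡ e) (n ∸ suc y) (∸-monoʳ-< {n} {suc y} {0} z<s y<n)))
    τ-has-upfix : hasUpfix n n τ ≡ true
    τ-has-upfix = hasUpfix⁺ n n τ (λ j j<n →
      j<n , subst (_∈ τ) (sym (+-∸-assoc 1 j<n)) (letter⁺ (n ∸ suc j) (∸-monoʳ-< {n} {suc j} {0} z<s j<n)))

  isHit-τ : ∀ Π → τ ∈ Π → isHit Π τ ≡ true
  isHit-τ Π τ∈Π = does-true (isHit? Π τ) (subst (_∈ Π) (sym st-τ) τ∈Π)

  isHit-τ⁻ : ∀ Π → τ ∉ Π → isHit Π τ ≡ false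
  isHit-τ⁻ Π τ∉Π = does-false (isHit? Π τ) (λ st∈ → τ∉Π (subst (_∈ Π) st-τ st∈))

  P-beyond-length : ∀ Π i → n < i → P Π i τ ≡ 0
  P-beyond-length Π i n<i = trans (P-as-count Π i τ) (count-none _ (subsequences τ)
    (λ s _ → cong (_∧ isHit Π s) (hasUpfix-beyond (length τ) i s (subst (_< i) (sym length-τ) n<i))))

  -- A subsequence containing the i-upfix has at least i letters: it contains every letter
  -- of τ above n - i, and there are i of them.
  upfix-size : ∀ i s → i ≤ n → s ∈ subsequences τ → hasUpfix n i s ≡ true → i ≤ length s
  upfix-size i s i≤n s∈ u = subst (_≤ length s) (trans (count-on-covering τ s above distinct-τ s∈ covers) count-above)
                              (count≤length above s)
    where
    above : ℕ → Bool
    above y = n ∸ i <ᵇ y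
    count-above : count above τ ≡ i
    count-above = begin
        count above τ
      ≡⟨ count-τ above ⟩
        count (λ y → n ∸ i <ᵇ suc y) (upTo n)
      ≡⟨ count-cong _ _ (upTo n) (λ y _ → <ᵇ-suc-not (n ∸ i) y) ⟩
        count (λ y → not (y <ᵇ n ∸ i)) (upTo n)
      ≡⟨ count-atLeast n (n ∸ i) (m∸n≤m n i) ⟩
        n ∸ (n ∸ i)
      ≡⟨ m∸[m∸n]≡n i≤n ⟩
        i ∎
      where open ≡-Reasoning
    covers : ∀ x → x ∈ τ → above x ≡ true → x ∈ s
    covers x x∈ ax with letter⁻ x x∈
    ... | y , refl , y<n = subst (_∈ s) (m∸[m∸n]≡n y<n)
          (proj₂ (hasUpfix⁻ n i s u (n ∸ suc y) (upfix-index n i y i≤n (≤-pred (<ᵇ-true⁻ (n ∸ i) (suc y) ax)) y<n)))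

  -- P_i(τ) = 0 for k < i < n, since a hit has at most k letters.
  P-beyond-maxLen : ∀ Π i → i < n → maxLen Π < i → P Π i τ ≡ 0
  P-beyond-maxLen Π i i<n k<i = trans (P-as-count Π i τ)
    (trans (cong (λ N → count (λ s → hasUpfix N i s ∧ isHit Π s) (subsequences τ)) length-τ)
           (count-none _ (subsequences τ) no-hit))
    where
    no-hit : ∀ s → s ∈ subsequences τ → (hasUpfix n i s ∧ isHit Π s) ≡ false
    no-hit s s∈ with hasUpfix n i s ∧ isHit Π s in eq
    ... | false = refl
    ... | true  = ⊥-elim (<-irrefl refl (<-≤-trans k<i (≤-trans (upfix-size i s (<⇒≤ i<n) s∈ (∧-trueˡ eq)) short)))
      where
      short : length s ≤ maxLen Π
      short = subst (_≤ maxLen Π) (length-map _ s) (length≤maxLen Π (st s) (does-true⁻ (isHit? Π s) (∧-trueʳ eq)))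

module Deletion (m : ℕ) (τ : List ℕ) (perm : IsPermOf (suc m) τ) where
  open Permutation (suc m) τ perm

  length-delete : ∀ e → e ≤ m → length (delete (suc e) τ) ≡ m
  length-delete e e≤m = begin
      length (delete (suc e) τ)
    ≡⟨ length-filter-count _ τ ⟩
      count (λ x → not (x ≡ᵇ suc e)) τ
    ≡⟨ count-τ _ ⟩
      count (λ y → not (y ≡ᵇ e)) (upTo (suc m))
    ≡⟨ count-cong _ _ (upTo (suc m)) (λ y y∈ →
         sym (trans (cong (not (y ≡ᵇ e) ∧_) (<ᵇ-true (∈-upTo⁻ y∈))) (∧-identityʳ _))) ⟩
      count (λ y → not (y ≡ᵇ e) ∧ (y <ᵇ suc m)) (upTo (suc m))
    ≡⟨ count-below-except (suc m) (suc m) e ≤-refl ⟩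
      closeGap e (suc m)
    ≡⟨ closeGap-suc e m e≤m ⟩
      m ∎
    where open ≡-Reasoning

  st-delete : ∀ e → st (delete (suc e) τ) ≡ map (closeGap (suc e)) (delete (suc e) τ)
  st-delete e = map-cong-local (All.tabulate (λ {x} x∈ → rank x x∈))
    where
    f = delete (suc e) τ
    rank : ∀ x → x ∈ f → suc (length (filter (_<? x) f)) ≡ closeGap (suc e) x
    rank x x∈ with letter⁻ x (proj₁ (∈-filter⁻ (λ z → ¬? (z ≟ suc e)) {xs = τ} x∈))
    ... | y , refl , y<n = trans (cong suc (begin
          length (filter (_<? suc y) f)
        ≡⟨ length-filter-count _ f ⟩
          count (λ z → z <ᵇ suc y) f
        ≡⟨ count-filter _ _ τ ⟩
          count (λ z → not (z ≡ᵇ suc e) ∧ (z <ᵇ suc y)) τ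
        ≡⟨ count-τ _ ⟩
          count (λ z → not (z ≡ᵇ e) ∧ (z <ᵇ y)) (upTo (suc m))
        ≡⟨ count-below-except (suc m) y e (<⇒≤ y<n) ⟩
          closeGap e y ∎)) (suc-closeGap e y)
      where open ≡-Reasoning

  -- The recurrence: split the hits containing the i-upfix by whether they contain
  -- d = (m+1) - i; those without d correspond to the hits of τ↓_{i+1} via closeGap d.
  P-recurrence : ∀ Π i → i ≤ m → P Π i τ ≡ P Π (suc i) τ + P Π i (down τ (suc i))
  P-recurrence Π i i≤m = begin
      P Π i τ
    ≡⟨ P-on τ i length-τ ⟩
      count Q (S τ)
    ≡⟨ count-split Q (mem d) (S τ) ⟩
      count (λ s → Q s ∧ mem d s) (S τ) + count (λ s → Q s ∧ not (mem d s)) (S τ)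
    ≡⟨ cong₂ _+_ (count-cong _ _ (S τ) (λ s _ → with-d s)) (count-avoiding d Q τ) ⟩
      count (λ s → hasUpfix n (suc i) s ∧ isHit Π s) (S τ) + count Q (S f)
    ≡⟨ cong₂ _+_ (sym (P-on τ (suc i) length-τ)) without-d ⟩
      P Π (suc i) τ + count (λ s → hasUpfix m i s ∧ isHit Π s) (S (st f))
    ≡⟨ cong (P Π (suc i) τ +_) (sym (P-on (st f) i (trans (length-map _ f) (length-delete e (m∸n≤m m i))))) ⟩
      P Π (suc i) τ + P Π i (st f)
    ≡⟨ cong (λ w → P Π (suc i) τ + P Π i w) (sym down-is-st) ⟩
      P Π (suc i) τ + P Π i (down τ (suc i)) ∎
    where
    open ≡-Reasoning
    n = suc m
    S = subsequences
    e = m ∸ i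
    d = suc e
    g = closeGap d
    f = delete d τ
    Q : List ℕ → Bool
    Q s = hasUpfix n i s ∧ isHit Π s
    P-on : ∀ w j {N} → length w ≡ N → P Π j w ≡ count (λ s → hasUpfix N j s ∧ isHit Π s) (S w)
    P-on w j refl = P-as-count Π j w
    with-d : ∀ s → (Q s ∧ mem d s) ≡ (hasUpfix n (suc i) s ∧ isHit Π s)
    with-d s rewrite hasUpfix-suc n i s (s≤s i≤m) | +-∸-assoc 1 i≤m = ∧-swapʳ (hasUpfix n i s) (isHit Π s) (mem d s)
    down-is-st : down τ (suc i) ≡ st f
    down-is-st = cong (λ c → st (delete c τ)) (trans (cong (λ N → N ∸ suc i + 1) length-τ) (+-comm e 1))
    f∌d : ∀ s → s ∈ S f → ∀ y → y ∈ s → y ≢ d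
    f∌d s s∈ y y∈ = proj₂ (∈-filter⁻ (λ z → ¬? (z ≟ d)) {xs = τ} (subsequence-⊆ f s s∈ y y∈))
    without-d : count Q (S f) ≡ count (λ s → hasUpfix m i s ∧ isHit Π s) (S (st f))
    without-d = sym (begin
        count (λ s → hasUpfix m i s ∧ isHit Π s) (S (st f))
      ≡⟨ cong (λ w → count (λ s → hasUpfix m i s ∧ isHit Π s) (S w)) (st-delete e) ⟩
        count (λ s → hasUpfix m i s ∧ isHit Π s) (S (map g f))
      ≡⟨ cong (count (λ s → hasUpfix m i s ∧ isHit Π s)) (subsequences-map g f) ⟩
        count (λ s → hasUpfix m i s ∧ isHit Π s) (map (map g) (S f))
      ≡⟨ count-map _ (map g) (S f) ⟩
        count (λ s → hasUpfix m i (map g s) ∧ isHit Π (map g s)) (S f)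
      ≡⟨ count-cong _ _ (S f) (λ s s∈ → cong₂ _∧_ (hasUpfix-closeGap m i s i≤m (f∌d s s∈))
            (isHit-st Π (st-closeGap d s (f∌d s s∈)))) ⟩
        count Q (S f) ∎)

proposition5p3 : (Π : List (List ℕ)) → (∀ π → π ∈ Π → IsPerm π) → Π ≢ [] →
    (n : ℕ) (τ : List ℕ) → IsPermOf n τ → (i : ℕ) →
      ((i < n) → (i ≤ maxLen Π) → P Π i τ ≡ P Π (suc i) τ + P Π i (down τ (suc i)))
      × ((i ≡ n) → (τ ∈ Π) → P Π i τ ≡ 1)
      × (¬ ((i < n) × (i ≤ maxLen Π)) → ¬ ((i ≡ n) × (τ ∈ Π)) → P Π i τ ≡ 0)
proposition5p3 Π _ _ n τ perm i = recurrence n perm , top , vanishing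
  where
  open Permutation n τ perm
  recurrence : ∀ n → IsPermOf n τ → i < n → i ≤ maxLen Π → P Π i τ ≡ P Π (suc i) τ + P Π i (down τ (suc i))
  recurrence (suc m) perm′ (s≤s i≤m) _ = Deletion.P-recurrence m τ perm′ Π i i≤m
  top : i ≡ n → τ ∈ Π → P Π i τ ≡ 1
  top refl τ∈Π = trans (P-full Π) (cong (λ b → if b then 1 else 0) (isHit-τ Π τ∈Π))
  vanishing : ¬ ((i < n) × (i ≤ maxLen Π)) → ¬ ((i ≡ n) × (τ ∈ Π)) → P Π i τ ≡ 0
  vanishing ¬rec ¬top with <-cmp i n
  ... | tri< i<n _ _  = P-beyond-maxLen Π i i<n (≰⇒> (λ i≤k → ¬rec (i<n , i≤k)))
  ... | tri> _ _ n<i  = P-beyond-length Π i n<i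
  ... | tri≈ _ refl _ = trans (P-full Π) (cong (λ b → if b then 1 else 0) (isHit-τ⁻ Π (λ τ∈Π → ¬top (refl , τ∈Π))))
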